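{- Let $\Phi$ be a finite crystallographic root system with simple roots $\Delta$. The map $A\mapsto(\operatorname{top}(A),\operatorname{bottom}(A))$ is a bijection from the set of antichains in the doubled root poset of $\Phi$ to the set of pairs of twin nonnesting partitions.
   Context: Root poset: the positive roots with $\alpha\le\beta$ iff $\beta-\alpha$ is a nonnegative combination of simple roots. Doubled root poset: a top copy of the root poset together with a bottom copy of its dual poset, the two copies of each simple root identified; a bottom element $\gamma$ lies below a top element $\beta$ iff some simple root $\alpha$ satisfies $\alpha\le\gamma$ and $\alpha\le\beta$ in the root poset. For an antichain $A$ of the doubled root poset, $\operatorname{top}(A)$ (resp. $\operatorname{bottom}(A)$) is the set of positive roots in $A$ lying in the top (resp. bottom) copy (simple roots lie in both). A nonnesting partition is an antichain in the root poset. The support of a root is the set of simple roots with nonzero coefficient in its expansion in $\Delta$; the support of a set of roots is the union of supports. For a set $A$ of roots, $A^\circ$ is the set of non-simple roots in $A$. A pair $(A_1,A_2)$ of nonnesting partitions is a pair of twin nonnesting partitions iff $A_1\cap\Delta=A_2\cap\Delta$ and $\operatorname{supp}(A_1^\circ)\cap\operatorname{supp}(A_2^\circ)=\emptyset$. -}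

module Defs where

open import Level using (0ℓ)
open import Data.Nat using (ℕ)
open import Data.Fin using (Fin) renaming (_≟_ to _≟ᶠ_)
open import Data.Integer using (ℤ; +_; _+_; _*_; _-_) renaming (_≤_ to _≤ℤ_)
open import Data.Vec using (Vec; tabulate; lookup; zipWith; map; foldr)
open import Data.Vec.Relation.Binary.Pointwise.Inductive using (Pointwise)
open import Data.Vec.Relation.Unary.All using (All)
open import Data.List using (List)
open import Data.List.Membership.Propositional using (_∈_)
open import Data.Product using (Σ; ∃; _×_; _,_)
open import Data.Sum using (_⊎_)
open import Data.Empty using (⊥)
open import Data.Bool using (if_then_else_)
open import Relation.Nullary using (¬_; does)
open import Relation.Binary.PropositionalEquality using (_≡_; _≢_)
open import Relation.Unary using (Pred)

-- Roots are written by their coefficient vectors in the basis Δ of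
-- simple roots (so a vector in ℤ^n, n = |Δ| the rank).

Vector : ℕ → Set
Vector n = Vec ℤ n

e : ∀ {n} → Fin n → Vector n
e i = tabulate λ j → if does (i ≟ᶠ j) then + 1 else + 0

IsSimple : ∀ {n} → Vector n → Set
IsSimple β = ∃ λ i → β ≡ e i

sumℤ : ∀ {n} → Vec ℤ n → ℤ
sumℤ = foldr _ _+_ (+ 0)

-- Crystallographic root systems via (generalized) Cartan matrices.
-- entry i j = ⟨α_i^∨ , α_j⟩.

record CartanMatrix (n : ℕ) : Set where
  field
    entry   : Fin n → Fin n → ℤ
    diag    : ∀ i → entry i i ≡ + 2
    offdiag : ∀ i j → i ≢ j → entry i j ≤ℤ + 0
    zeroSym : ∀ i j → entry i j ≡ + 0 → entry j i ≡ + 0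

open CartanMatrix public

module _ {n : ℕ} (C : CartanMatrix n) where

  pairing : Fin n → Vector n → ℤ
  pairing i β = sumℤ (tabulate λ j → entry C i j * lookup β j)

  reflect : Fin n → Vector n → Vector n
  reflect i β = zipWith _-_ β (map (pairing i β *_) (e i))

  -- the (real) roots: the orbit of the simple roots under the Weyl group
  data Root : Vector n → Set where
    simple : ∀ i → Root (e i)
    refl-s : ∀ i {β} → Root β → Root (reflect i β)

  IsFiniteType : Set
  IsFiniteType = Σ (List (Vector n)) λ L → ∀ β → Root β → β ∈ L

  PosRoot : Vector n → Set
  PosRoot β = Root β × All (λ c → + 0 ≤ℤ c) β

_≼_ : ∀ {n} → Vector n → Vector n → Set
β ≼ β' = Pointwise _≤ℤ_ β β'

module _ {n : ℕ} (C : CartanMatrix n) where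

  -- nonnesting partition: antichain in the root poset
  IsNonnesting : Pred (Vector n) 0ℓ → Set
  IsNonnesting A =
    (∀ β → A β → PosRoot C β) ×
    (∀ β β' → A β → A β' → β ≼ β' → β ≡ β')

InSupp : ∀ {n} → Pred (Vector n) 0ℓ → Fin n → Set
InSupp A i = ∃ λ β → A β × lookup β i ≢ + 0

nonSimple : ∀ {n} → Pred (Vector n) 0ℓ → Pred (Vector n) 0ℓ
nonSimple A β = A β × ¬ IsSimple β

module _ {n : ℕ} (C : CartanMatrix n) where

  IsTwinPair : Pred (Vector n) 0ℓ → Pred (Vector n) 0ℓ → Set
  IsTwinPair A₁ A₂ =
    IsNonnesting C A₁ × IsNonnesting C A₂ ×
    (∀ i → (A₁ (e i) → A₂ (e i)) × (A₂ (e i) → A₁ (e i))) ×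
    (∀ i → ¬ (InSupp (nonSimple A₁) i × InSupp (nonSimple A₂) i))

-- Elements: top β (β ∈ Φ⁺, the top copy, which also
-- carries the simple roots) and bot γ (γ ∈ Φ⁺ non-simple, the bottom copy;
-- the bottom copy of a simple root is identified with its top copy).

data DElt (n : ℕ) : Set where
  top : Vector n → DElt n
  bot : Vector n → DElt n

module _ {n : ℕ} (C : CartanMatrix n) where

  IsDElt : DElt n → Set
  IsDElt (top β) = PosRoot C β
  IsDElt (bot γ) = PosRoot C γ × ¬ IsSimple γ

_⊑_ : ∀ {n} → DElt n → DElt n → Set
top β ⊑ top β' = β ≼ β'
bot γ ⊑ bot γ' = γ' ≼ γ
bot γ ⊑ top β  = ∃ λ i → (e i ≼ γ) × (e i ≼ β)
top β ⊑ bot γ  = ⊥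

module _ {n : ℕ} (C : CartanMatrix n) where

  IsDoubledAntichain : Pred (DElt n) 0ℓ → Set
  IsDoubledAntichain A =
    (∀ x → A x → IsDElt C x) ×
    (∀ x y → A x → A y → x ⊑ y → x ≡ y)

topOf : ∀ {n} → Pred (DElt n) 0ℓ → Pred (Vector n) 0ℓ
topOf A β = A (top β)

bottomOf : ∀ {n} → Pred (DElt n) 0ℓ → Pred (Vector n) 0ℓ
bottomOf A γ = A (bot γ) ⊎ (IsSimple γ × A (top γ))

-- A doubled antichain A is recovered from (top A, bottom A): its bottom copy
-- consists of the non-simple roots of bottom A.  A non-simple top β and a
-- non-simple bottom γ of A with a common simple root αᵢ in their supports would
-- satisfy γ ⊑ β through αᵢ, so the supports of the two halves are disjoint.
-- Conversely, for twins (A₁, A₂) a comparability γ ⊑ β between γ ∈ A₂° and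
-- β ∈ A₁ goes through some αᵢ ≤ γ, β: for non-simple β this contradicts the
-- disjointness of supports, and for β = αᵢ the antichain A₂ would contain
-- αᵢ < γ.  The only fact about roots used is that every root is nonzero, so
-- that every positive root lies above a simple root.
module Submission where

open import Defs
open import Level using (0ℓ)
open import Data.Nat using (ℕ; zero; suc)
open import Data.Product using (∃; _×_; _,_; proj₁; proj₂)
open import Relation.Unary using (Pred; _≐_)
open import Data.Fin using (Fin) renaming (_≟_ to _≟ᶠ_; zero to fzero; suc to fsuc)
open import Data.Fin.Properties using (any?; suc-injective)
open import Data.Integer using (ℤ; +_; _-_; _*_; -_; +≤+) renaming (_≤_ to _≤ℤ_)
import Data.Integer.Properties as ℤ
open import Data.Integer.Tactic.RingSolver using (solve-∀)
open import Data.Vec using (tabulate; lookup; zipWith; map)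
open import Data.Vec.Properties using (lookup∘tabulate; lookup-zipWith; lookup-map; ≡-dec)
import Data.Vec.Relation.Binary.Pointwise.Inductive as Pointwise
open import Data.Vec.Relation.Binary.Pointwise.Extensional using (ext; extensional⇒inductive)
open import Data.Vec.Relation.Unary.All using (All)
open import Data.Vec.Relation.Unary.All.Properties using (lookup⁺)
open import Data.Sum using (inj₁; inj₂)
open import Data.Empty using (⊥-elim)
open import Data.Bool using (if_then_else_)
open import Function using (_∘_)
open import Relation.Nullary using (¬_; does; Dec; yes; no)
open import Relation.Nullary.Decidable using (¬?; _×-dec_)
open import Relation.Binary.PropositionalEquality using (_≡_; _≢_; refl; sym; trans; cong; cong₂; subst₂; module ≡-Reasoning)

lookup-e-self : ∀ {n} (i : Fin n) → lookup (e i) i ≡ + 1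
lookup-e-self i rewrite lookup∘tabulate (λ j → if does (i ≟ᶠ j) then + 1 else + 0) i
  with i ≟ᶠ i
... | yes _   = refl
... | no i≢i = ⊥-elim (i≢i refl)

lookup-e-other : ∀ {n} {i j : Fin n} → i ≢ j → lookup (e i) j ≡ + 0
lookup-e-other {i = i} {j} i≢j rewrite lookup∘tabulate (λ k → if does (i ≟ᶠ k) then + 1 else + 0) j
  with i ≟ᶠ j
... | yes i≡j = ⊥-elim (i≢j i≡j)
... | no _    = refl

e≼⇒lookup≢0 : ∀ {n} {i : Fin n} {β : Vector n} → e i ≼ β → lookup β i ≢ + 0
e≼⇒lookup≢0 {i = i} eᵢ≼β βᵢ≡0 =
  1≰0 (subst₂ _≤ℤ_ (lookup-e-self i) βᵢ≡0 (Pointwise.lookup eᵢ≼β i))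
  where
  1≰0 : ¬ (+ 1 ≤ℤ + 0)
  1≰0 (+≤+ ())

lookup≢0⇒e≼ : ∀ {n} {i : Fin n} {β : Vector n} →
  All (+ 0 ≤ℤ_) β → lookup β i ≢ + 0 → e i ≼ β
lookup≢0⇒e≼ {i = i} {β} β≥0 βᵢ≢0 = extensional⇒inductive (ext coordinate)
  where
  coordinate : ∀ j → lookup (e i) j ≤ℤ lookup β j
  coordinate j with i ≟ᶠ j
  ... | yes refl rewrite lookup-e-self i =
          ℤ.i<j⇒suc[i]≤j (ℤ.≤∧≢⇒< (lookup⁺ β≥0 i) (βᵢ≢0 ∘ sym))
  ... | no i≢j rewrite lookup-e-other i≢j = lookup⁺ β≥0 j

e≼e⇒≡ : ∀ {n} {i j : Fin n} → e i ≼ e j → i ≡ j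
e≼e⇒≡ {i = i} {j} eᵢ≼eⱼ with j ≟ᶠ i
... | yes j≡i = sym j≡i
... | no j≢i  = ⊥-elim (e≼⇒lookup≢0 eᵢ≼eⱼ (lookup-e-other j≢i))

sumℤ-tabulate-zero : ∀ {n} (f : Fin n → ℤ) → (∀ j → f j ≡ + 0) → sumℤ (tabulate f) ≡ + 0
sumℤ-tabulate-zero {zero}  f f≡0 = refl
sumℤ-tabulate-zero {suc n} f f≡0
  rewrite f≡0 fzero | sumℤ-tabulate-zero (f ∘ fsuc) (f≡0 ∘ fsuc) = refl

sumℤ-tabulate-single : ∀ {n} (f : Fin n → ℤ) (i : Fin n) →
  (∀ j → j ≢ i → f j ≡ + 0) → sumℤ (tabulate f) ≡ f i
sumℤ-tabulate-single {suc n} f fzero f≡0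
  rewrite sumℤ-tabulate-zero (f ∘ fsuc) (λ j → f≡0 (fsuc j) (λ ())) = ℤ.+-identityʳ (f fzero)
sumℤ-tabulate-single {suc n} f (fsuc i) f≡0
  rewrite f≡0 fzero (λ ())
        | sumℤ-tabulate-single (f ∘ fsuc) i (λ j j≢i → f≡0 (fsuc j) (j≢i ∘ suc-injective))
  = ℤ.+-identityˡ (f (fsuc i))

IsNonZero : ∀ {n} → Vector n → Set
IsNonZero β = ∃ λ k → lookup β k ≢ + 0

module _ {n : ℕ} (C : CartanMatrix n) where

  lookup-reflect : ∀ i β j → lookup (reflect C i β) j ≡ lookup β j - pairing C i β * lookup (e i) j
  lookup-reflect i β j
    rewrite lookup-zipWith _-_ j β (map (pairing C i β *_) (e i))
          | lookup-map j (pairing C i β *_) (e i) = refl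

  lookup-reflect-other : ∀ {i j} β → i ≢ j → lookup (reflect C i β) j ≡ lookup β j
  lookup-reflect-other {i} {j} β i≢j = begin
    lookup (reflect C i β) j                    ≡⟨ lookup-reflect i β j ⟩
    lookup β j - pairing C i β * lookup (e i) j ≡⟨ cong (λ c → lookup β j - pairing C i β * c) (lookup-e-other i≢j) ⟩
    lookup β j - pairing C i β * + 0            ≡⟨ x-p*0≡x (lookup β j) (pairing C i β) ⟩
    lookup β j                                  ∎
    where
    open ≡-Reasoning
    x-p*0≡x : ∀ x p → x - p * + 0 ≡ x
    x-p*0≡x = solve-∀

  module _ {i : Fin n} {β : Vector n} (supported : ∀ j → j ≢ i → lookup β j ≡ + 0) where

    pairing-supported : pairing C i β ≡ + 2 * lookup β i
    pairing-supported = begin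
      pairing C i β                ≡⟨ sumℤ-tabulate-single _ i entry-β≡0 ⟩
      entry C i i * lookup β i     ≡⟨ cong (_* lookup β i) (diag C i) ⟩
      + 2 * lookup β i             ∎
      where
      open ≡-Reasoning
      entry-β≡0 : ∀ j → j ≢ i → entry C i j * lookup β j ≡ + 0
      entry-β≡0 j j≢i rewrite supported j j≢i = ℤ.*-zeroʳ (entry C i j)

    lookup-reflect-supported : lookup (reflect C i β) i ≡ - lookup β i
    lookup-reflect-supported = begin
      lookup (reflect C i β) i                    ≡⟨ lookup-reflect i β i ⟩
      lookup β i - pairing C i β * lookup (e i) i ≡⟨ cong₂ (λ p u → lookup β i - p * u) pairing-supported (lookup-e-self i) ⟩
      lookup β i - (+ 2 * lookup β i) * + 1       ≡⟨ x-2x*1≡-x (lookup β i) ⟩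
      - lookup β i                                ∎
      where
      open ≡-Reasoning
      x-2x*1≡-x : ∀ x → x - (+ 2 * x) * + 1 ≡ - x
      x-2x*1≡-x = solve-∀

  -- Either β has a nonzero coordinate off i, which the reflection keeps, or β
  -- is a multiple of αᵢ and is negated.
  reflect-nonZero : ∀ i {β} → IsNonZero β → IsNonZero (reflect C i β)
  reflect-nonZero i {β} (k , βₖ≢0)
    with any? (λ j → ¬? (i ≟ᶠ j) ×-dec ¬? (lookup β j ℤ.≟ + 0))
  ... | yes (j , i≢j , βⱼ≢0) = j , βⱼ≢0 ∘ trans (sym (lookup-reflect-other β i≢j))
  ... | no noOther = i , βᵢ≢0 ∘ ℤ.neg-injective ∘ trans (sym (lookup-reflect-supported {i} {β} supported))
    where
    supported : ∀ j → j ≢ i → lookup β j ≡ + 0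
    supported j j≢i with lookup β j ℤ.≟ + 0
    ... | yes βⱼ≡0 = βⱼ≡0
    ... | no βⱼ≢0  = ⊥-elim (noOther (j , j≢i ∘ sym , βⱼ≢0))
    βᵢ≢0 : lookup β i ≢ + 0
    βᵢ≢0 with k ≟ᶠ i
    ... | yes refl = βₖ≢0
    ... | no k≢i   = ⊥-elim (βₖ≢0 (supported k k≢i))

  root-nonZero : ∀ {β} → Root C β → IsNonZero β
  root-nonZero (simple i)   = i , λ eᵢᵢ≡0 → 1≢0 (trans (sym (lookup-e-self i)) eᵢᵢ≡0)
    where
    1≢0 : + 1 ≢ + 0
    1≢0 ()
  root-nonZero (refl-s i {β} r) = reflect-nonZero i {β} (root-nonZero r)

  posRoot⇒e≼ : ∀ {β} → PosRoot C β → ∃ λ i → e i ≼ β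
  posRoot⇒e≼ (root , β≥0) with root-nonZero root
  ... | i , βᵢ≢0 = i , lookup≢0⇒e≼ β≥0 βᵢ≢0

isSimple? : ∀ {n} (β : Vector n) → Dec (IsSimple β)
isSimple? β = any? (λ i → ≡-dec ℤ._≟_ β (e i))

top-injective : ∀ {n} {β β′ : Vector n} → top β ≡ top β′ → β ≡ β′
top-injective refl = refl

bot-injective : ∀ {n} {γ γ′ : Vector n} → bot γ ≡ bot γ′ → γ ≡ γ′
bot-injective refl = refl

bot≢top : ∀ {n} {γ β : Vector n} → bot γ ≢ top β
bot≢top ()

module _ {n : ℕ} (C : CartanMatrix n) {A : Pred (DElt n) 0ℓ} (A-antichain : IsDoubledAntichain C A) where

  private
    isElt = proj₁ A-antichain
    incomparable = proj₂ A-antichain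

  topOf-nonnesting : IsNonnesting C (topOf A)
  topOf-nonnesting = (λ β → isElt (top β))
                   , (λ β β′ a a′ β≼β′ → top-injective (incomparable _ _ a a′ β≼β′))

  bottomOf-posRoot : ∀ γ → bottomOf A γ → PosRoot C γ
  bottomOf-posRoot γ (inj₁ a)       = proj₁ (isElt (bot γ) a)
  bottomOf-posRoot γ (inj₂ (_ , a)) = isElt (top γ) a

  bottomOf-incomparable : ∀ γ γ′ → bottomOf A γ → bottomOf A γ′ → γ ≼ γ′ → γ ≡ γ′
  bottomOf-incomparable γ γ′ (inj₁ a) (inj₁ a′) γ≼γ′ =
    sym (bot-injective (incomparable _ _ a′ a γ≼γ′))
  bottomOf-incomparable γ _ (inj₁ a) (inj₂ ((i , refl) , a′)) γ≼eᵢ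
    with posRoot⇒e≼ C (proj₁ (isElt (bot γ) a))
  ... | k , eₖ≼γ with e≼e⇒≡ {i = k} {j = i} (Pointwise.trans ℤ.≤-trans eₖ≼γ γ≼eᵢ)
  ... | refl = ⊥-elim (bot≢top (incomparable _ _ a a′ (i , eₖ≼γ , Pointwise.refl ℤ.≤-refl)))
  bottomOf-incomparable _ γ′ (inj₂ ((i , refl) , a)) (inj₁ a′) eᵢ≼γ′ =
    ⊥-elim (bot≢top (incomparable _ _ a′ a (i , eᵢ≼γ′ , Pointwise.refl ℤ.≤-refl)))
  bottomOf-incomparable _ _ (inj₂ ((_ , refl) , a)) (inj₂ ((_ , refl) , a′)) eᵢ≼eⱼ =
    top-injective (incomparable _ _ a a′ eᵢ≼eⱼ)

  bottomOf-nonnesting : IsNonnesting C (bottomOf A)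
  bottomOf-nonnesting = bottomOf-posRoot , bottomOf-incomparable

  simple-topOf⇔bottomOf : ∀ i → (topOf A (e i) → bottomOf A (e i)) × (bottomOf A (e i) → topOf A (e i))
  simple-topOf⇔bottomOf i = (λ a → inj₂ ((i , refl) , a)) , λ
    { (inj₁ a)       → ⊥-elim (proj₂ (isElt (bot (e i)) a) (i , refl))
    ; (inj₂ (_ , a)) → a
    }

  nonSimple-supports-disjoint :
    ∀ i → ¬ (InSupp (nonSimple (topOf A)) i × InSupp (nonSimple (bottomOf A)) i)
  nonSimple-supports-disjoint i ((β , (a , _) , βᵢ≢0) , (γ , (inj₁ b , _) , γᵢ≢0)) =
    bot≢top (incomparable _ _ b a
      (i , lookup≢0⇒e≼ (proj₂ (proj₁ (isElt _ b))) γᵢ≢0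
         , lookup≢0⇒e≼ (proj₂ (isElt _ a)) βᵢ≢0))
  nonSimple-supports-disjoint i (_ , (_ , (inj₂ (γ-simple , _) , γ-nonSimple) , _)) =
    γ-nonSimple γ-simple

  topOf-bottomOf-isTwinPair : IsTwinPair C (topOf A) (bottomOf A)
  topOf-bottomOf-isTwinPair = topOf-nonnesting , bottomOf-nonnesting
                            , simple-topOf⇔bottomOf , nonSimple-supports-disjoint

module _ {n : ℕ} (C : CartanMatrix n) where

  ⊆-from-topOf-bottomOf : ∀ {A A′ : Pred (DElt n) 0ℓ} → IsDoubledAntichain C A →
    (∀ {β} → topOf A β → topOf A′ β) → (∀ {γ} → bottomOf A γ → bottomOf A′ γ) →
    ∀ {x} → A x → A′ x
  ⊆-from-topOf-bottomOf _ top⊆ _ {top β} a = top⊆ a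
  ⊆-from-topOf-bottomOf (isElt , _) _ bottom⊆ {bot γ} a with bottom⊆ (inj₁ a)
  ... | inj₁ a′             = a′
  ... | inj₂ (γ-simple , _) = ⊥-elim (proj₂ (isElt _ a) γ-simple)

  topOf-bottomOf-injective : (A A′ : Pred (DElt n) 0ℓ) →
    IsDoubledAntichain C A → IsDoubledAntichain C A′ →
    topOf A ≐ topOf A′ → bottomOf A ≐ bottomOf A′ → A ≐ A′
  topOf-bottomOf-injective A A′ A-ac A′-ac (t⊆ , t⊇) (b⊆ , b⊇) =
    ⊆-from-topOf-bottomOf {A} {A′} A-ac t⊆ b⊆ , ⊆-from-topOf-bottomOf {A′} {A} A′-ac t⊇ b⊇

  doubled : Pred (Vector n) 0ℓ → Pred (Vector n) 0ℓ → Pred (DElt n) 0ℓ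
  doubled A₁ A₂ (top β) = A₁ β
  doubled A₁ A₂ (bot γ) = A₂ γ × ¬ IsSimple γ

  module _ {A₁ A₂ : Pred (Vector n) 0ℓ} (twins : IsTwinPair C A₁ A₂) where

    private
      A₁-nonnesting = proj₁ twins
      A₂-nonnesting = proj₁ (proj₂ twins)
      same-simple   = proj₁ (proj₂ (proj₂ twins))
      disjoint      = proj₂ (proj₂ (proj₂ twins))

    doubled-isElt : ∀ x → doubled A₁ A₂ x → IsDElt C x
    doubled-isElt (top β) a               = proj₁ A₁-nonnesting β a
    doubled-isElt (bot γ) (a , nonSimple) = proj₁ A₂-nonnesting γ a , nonSimple

    doubled-incomparable : ∀ x y → doubled A₁ A₂ x → doubled A₁ A₂ y → x ⊑ y → x ≡ y
    doubled-incomparable (top β) (top β′) a a′ β≼β′ =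
      cong top (proj₂ A₁-nonnesting β β′ a a′ β≼β′)
    doubled-incomparable (bot γ) (bot γ′) a a′ γ′≼γ =
      cong bot (sym (proj₂ A₂-nonnesting γ′ γ (proj₁ a′) (proj₁ a) γ′≼γ))
    doubled-incomparable (bot γ) (top β) (a , γ-nonSimple) b (i , eᵢ≼γ , eᵢ≼β) with isSimple? β
    ... | yes (j , refl) with e≼e⇒≡ {i = i} {j = j} eᵢ≼β
    ...   | refl = ⊥-elim (γ-nonSimple (i , sym eᵢ≡γ))
      where
      eᵢ≡γ : e i ≡ γ
      eᵢ≡γ = proj₂ A₂-nonnesting (e i) γ (proj₁ (same-simple i) b) a eᵢ≼γ
    doubled-incomparable (bot γ) (top β) (a , γ-nonSimple) b (i , eᵢ≼γ , eᵢ≼β) | no β-nonSimple =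
      ⊥-elim (disjoint i ( (β , (b , β-nonSimple) , e≼⇒lookup≢0 eᵢ≼β)
                         , (γ , (a , γ-nonSimple) , e≼⇒lookup≢0 eᵢ≼γ)))

    bottomOf-doubled : bottomOf (doubled A₁ A₂) ≐ A₂
    bottomOf-doubled = from , to
      where
      from : ∀ {γ} → bottomOf (doubled A₁ A₂) γ → A₂ γ
      from (inj₁ (a , _))          = a
      from (inj₂ ((i , refl) , b)) = proj₁ (same-simple i) b
      to : ∀ {γ} → A₂ γ → bottomOf (doubled A₁ A₂) γ
      to {γ} a with isSimple? γ
      ... | yes (i , refl) = inj₂ ((i , refl) , proj₂ (same-simple i) a)
      ... | no γ-nonSimple = inj₁ (a , γ-nonSimple)

    twinPair⇒doubledAntichain :
      ∃ λ (A : Pred (DElt n) 0ℓ) → IsDoubledAntichain C A × (topOf A ≐ A₁) × (bottomOf A ≐ A₂)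
    twinPair⇒doubledAntichain =
      doubled A₁ A₂ , (doubled-isElt , doubled-incomparable) , ((λ a → a) , (λ a → a))
                    , bottomOf-doubled

proposition2p3 : ∀ {n : ℕ} (C : CartanMatrix n) → IsFiniteType C →
    ((A : Pred (DElt n) 0ℓ) → IsDoubledAntichain C A →
      IsTwinPair C (topOf A) (bottomOf A)) ×
    ((A A′ : Pred (DElt n) 0ℓ) → IsDoubledAntichain C A → IsDoubledAntichain C A′ →
      topOf A ≐ topOf A′ → bottomOf A ≐ bottomOf A′ → A ≐ A′) ×
    ((A₁ A₂ : Pred (Vector n) 0ℓ) → IsTwinPair C A₁ A₂ →
      ∃ λ (A : Pred (DElt n) 0ℓ) → IsDoubledAntichain C A × (topOf A ≐ A₁) × (bottomOf A ≐ A₂))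
proposition2p3 C _ =
    (λ _ → topOf-bottomOf-isTwinPair C)
  , topOf-bottomOf-injective C
  , (λ _ _ → twinPair⇒doubledAntichain C)
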